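{- Let $T$ be a diagram, $r\geq1$ a row index and $c\geq1$ a column index. Then $\mathfrak{e}_r(T)\neq0$ if and only if $\mathfrak{e}_r(\mathfrak{R}_c(T))\neq0$, and in this case $\mathfrak{e}_r(\mathfrak{R}_c(T))=\mathfrak{R}_c(\mathfrak{e}_r(T))$.
   Context: A diagram is a finite set of cells $(c,r)$, $c,r$ positive integers ($c$ column, $r$ row, rows numbered from the bottom). Raising operators: for $i\geq1$, the $i$-pairing of cells of $T$ in rows $i,i+1$ first pairs cells of rows $i$ and $i+1$ lying in the same column, then iteratively pairs an unpaired cell in row $i$ with an unpaired cell in row $i+1$ strictly to its right whenever all cells of rows $i,i+1$ in the columns strictly between them are already paired. $\mathfrak{e}_i(T)=0$ if row $i+1$ has no unpaired cell; otherwise $\mathfrak{e}_i(T)$ moves the rightmost unpaired cell of row $i+1$ down to row $i$ in its column. Rectification operators: for $c\ge1$, the column $c$-pairing of cells of $T$ in columns $c,c+1$ first pairs cells of columns $c$ and $c+1$ lying in the same row, then iteratively pairs an unpaired cell in column $c+1$ with an unpaired cell in column $c$ above it whenever all cells of columns $c,c+1$ in the rows strictly between them are already paired. $\mathfrak{R}_c(T)=T$ if column $c+1$ has no unpaired cell; otherwise $\mathfrak{R}_c(T)$ moves the lowest unpaired cell of column $c+1$ left to column $c$ in its row, leaving all other cells fixed. -}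

module Defs where

open import Data.Bool using (Bool; true; false; _∧_; not)
open import Data.Nat using (ℕ; zero; suc; _⊔_; _≤_)
open import Data.Nat.Properties using () renaming (_≟_ to _≟ℕ_)
open import Data.Product using (_×_; _,_; proj₁; proj₂)
open import Data.Product.Properties using (≡-dec)
open import Data.List using (List; []; _∷_; upTo; last; filterᵇ; foldr)
open import Data.Bool.ListAction using (any)
open import Data.Maybe using (Maybe; just; nothing)
open import Data.List.Membership.Propositional using (_∈_)
open import Relation.Nullary.Decidable using (⌊_⌋)
open import Function.Bundles using (_⇔_)

-- A cell (c , r): c = column, r = row (rows numbered from the bottom).
Cell : Set
Cell = ℕ × ℕ

_≟c_ : (x y : Cell) → _
_≟c_ = ≡-dec _≟ℕ_ _≟ℕ_

-- A diagram: a finite set of cells, represented by a list (duplicates are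
-- irrelevant: all operations below only depend on membership, and
-- diagrams are compared up to equality of the underlying sets).
Diagram : Set
Diagram = List Cell

PositiveCell : Cell → Set
PositiveCell (c , r) = (1 ≤ c) × (1 ≤ r)

_≋_ : Diagram → Diagram → Set
T ≋ U = ∀ (x : Cell) → (x ∈ T) ⇔ (x ∈ U)

_∈ᵇ_ : Cell → Diagram → Bool
x ∈ᵇ T = any (λ y → ⌊ x ≟c y ⌋) T

remove : Cell → Diagram → Diagram
remove x T = filterᵇ (λ y → not ⌊ x ≟c y ⌋) T

bound : Diagram → ℕ
bound = foldr (λ x m → proj₁ x ⊔ proj₂ x ⊔ m) 0

range : Diagram → List ℕ
range T = upTo (suc (bound T))

-- Scanning columns from left to right, a column
-- containing both (col,i) and (col,i+1) is paired with itself; an unpaired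
-- row-i cell acts as an opening bracket, an unpaired row-(i+1) cell as a
-- closing bracket that pairs with a pending row-i cell to its left (all
-- cells strictly between being already paired).  The counter k is the
-- number of pending unpaired row-i cells.  We return the column of the
-- rightmost unpaired cell of row i+1 (if any).

rowStep : Bool → Bool → ℕ → ℕ → Maybe ℕ → (ℕ → Maybe ℕ → Maybe ℕ) → Maybe ℕ
rowStep true  true  col k       lst kont = kont k lst
rowStep true  false col k       lst kont = kont (suc k) lst
rowStep false true  col zero    lst kont = kont zero (just col)
rowStep false true  col (suc k) lst kont = kont k lst
rowStep false false col k       lst kont = kont k lst

rowScan : ℕ → Diagram → List ℕ → ℕ → Maybe ℕ → Maybe ℕ
rowScan i T []           k lst = lst
rowScan i T (col ∷ cols) k lst =
  rowStep ((col , i) ∈ᵇ T) ((col , suc i) ∈ᵇ T) col k lst (rowScan i T cols)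

rightmostUnpaired : ℕ → Diagram → Maybe ℕ
rightmostUnpaired i T = rowScan i T (range T) 0 nothing

-- raising operator e_i ; nothing represents 0
raise : ℕ → Diagram → Maybe Diagram
raise i T with rightmostUnpaired i T
... | nothing  = nothing
... | just col = just ((col , i) ∷ remove (col , suc i) T)

-- Scanning rows from bottom to top, a
-- row containing both (c,row) and (c+1,row) is paired with itself; an
-- unpaired column-(c+1) cell is an opening bracket, an unpaired column-c
-- cell is a closing bracket pairing with the nearest pending column-(c+1)
-- cell below it.  The stack holds the rows of pending column-(c+1) cells,
-- most recent first; at the end it holds exactly the unpaired cells of
-- column c+1, the lowest one being the last element.

colStep : Bool → Bool → ℕ → List ℕ → (List ℕ → List ℕ) → List ℕ
colStep true  true  row st       kont = kont st
colStep false true  row st       kont = kont (row ∷ st)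
colStep true  false row []       kont = kont []
colStep true  false row (_ ∷ st) kont = kont st
colStep false false row st       kont = kont st

colScan : ℕ → Diagram → List ℕ → List ℕ → List ℕ
colScan c T []           st = st
colScan c T (row ∷ rows) st =
  colStep ((c , row) ∈ᵇ T) ((suc c , row) ∈ᵇ T) row st (colScan c T rows)

lowestUnpaired : ℕ → Diagram → Maybe ℕ
lowestUnpaired c T = last (colScan c T (range T) [])

rectify : ℕ → Diagram → Diagram
rectify c T with lowestUnpaired c T
... | nothing  = T
... | just row = (c , row) ∷ remove (suc c , row) T

module Submission where

-- Both operators move one cell: R_c moves the lowest unpaired cell (c+1, z) of
-- the column pairing to (c, z), and e_r moves the rightmost unpaired cell
-- (w, r+1) of the row pairing to (w, r).  The row pairing scans columns and
-- the column pairing scans rows, and a move by one operator changes the bits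
-- seen by the other scan only inside the 2×2 block of columns c, c+1 and rows
-- r, r+1.  So we first rewrite both scans as left folds (`rowFold`, `colFold`)
-- and show that, for any diagram agreeing with T outside the block, each scan
-- is "fixed prefix, then the block, then a fixed suffix" (`LocalForm`).  A
-- finite analysis of the block (`RowBlock`, `ColBlock`) then shows that one
-- operator can only shift the answer of the other by one step across the
-- block (`Shift`).  Consequently e_r is defined before rectifying iff after
-- (`raise-defined-iff`), and the two composites perform the same pair of moves
-- (`interchange`): disjoint moves commute, and in the two remaining
-- configurations both composites equal the single move (c+1, r+1) ↦ (c, r).
-- Diagrams are compared through their Boolean membership functions (`mem`),
-- so these set identities reduce to Boolean identities about `moved`.

open import Defs
open import Data.Bool using (Bool; true; false; _∧_; _∨_; not)
open import Data.Bool.ListAction using (any)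
open import Data.Bool.Properties using (∨-zeroʳ; ∧-zeroʳ; ∧-identityʳ)
open import Data.Empty using (⊥-elim)
open import Data.Nat using (ℕ; zero; suc; _+_; _∸_; _≤_; _<_; _⊔_; _≟_; s≤s; z<s)
open import Data.Nat.Properties
open import Data.Product using (_×_; _,_; proj₁; proj₂; ∃)
open import Data.Product.Properties using (,-injectiveˡ; ,-injectiveʳ)
open import Data.Sum using (_⊎_; inj₁; inj₂)
open import Data.Maybe using (Maybe; just; nothing; _<∣>_; Is-just)
open import Data.Maybe.Properties using (just-injective)
open import Data.Maybe.Relation.Unary.Any using (just)
open import Data.List using (List; []; _∷_; _++_; drop; last; filterᵇ; applyUpTo; upTo)
open import Data.List.Properties using (++-assoc; ++-identityʳ)
open import Data.List.Membership.Propositional using (_∈_)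
open import Data.List.Relation.Unary.Any using (here; there)
open import Data.List.Relation.Unary.All using (All; []; _∷_)
import Data.List.Relation.Unary.All as All
open import Data.List.Relation.Unary.All.Properties using (++⁺; drop⁺; applyUpTo⁺₁; all-upTo)
open import Data.Unit using (tt)
open import Relation.Nullary using (¬_; yes; no)
open import Relation.Nullary.Decidable using (⌊_⌋)
open import Relation.Binary.PropositionalEquality
open import Function.Bundles using (_⇔_; mk⇔)
open import Function.Properties.Equivalence using () renaming (refl to ⇔-refl; sym to ⇔-sym; trans to ⇔-trans)

cong₄ : ∀ {X : Set} (f : Bool → Bool → Bool → Bool → X) {a b c d a′ b′ c′ d′} →
  a ≡ a′ → b ≡ b′ → c ≡ c′ → d ≡ d′ → f a b c d ≡ f a′ b′ c′ d′
cong₄ f refl refl refl refl = refl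

,≢ˡ : ∀ {a b c d : ℕ} → a ≢ c → (a , b) ≢ (c , d)
,≢ˡ a≢c e = a≢c (,-injectiveˡ e)

,≢ʳ : ∀ {a b c d : ℕ} → b ≢ d → (a , b) ≢ (c , d)
,≢ʳ b≢d e = b≢d (,-injectiveʳ e)

n≢1+n : ∀ n → n ≢ suc n
n≢1+n n e = 1+n≢n (sym e)

answer-unique : ∀ {m : Maybe ℕ} {x y} → m ≡ just x → m ≡ just y → x ≡ y
answer-unique m≡x m≡y = just-injective (trans (sym m≡x) m≡y)

_≡ᵇ_ : Cell → Cell → Bool
x ≡ᵇ y = ⌊ x ≟c y ⌋

≡ᵇ-refl : ∀ x → x ≡ᵇ x ≡ true
≡ᵇ-refl x with x ≟c x
... | yes _ = refl
... | no x≢x = ⊥-elim (x≢x refl)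

≡ᵇ-false : ∀ {x y} → x ≢ y → x ≡ᵇ y ≡ false
≡ᵇ-false {x} {y} x≢y with x ≟c y
... | yes x≡y = ⊥-elim (x≢y x≡y)
... | no _ = refl

≡ᵇ-sym : ∀ x y → x ≡ᵇ y ≡ y ≡ᵇ x
≡ᵇ-sym x y with x ≟c y | y ≟c x
... | yes _ | yes _ = refl
... | no _  | no _  = refl
... | yes x≡y | no y≢x = ⊥-elim (y≢x (sym x≡y))
... | no x≢y  | yes y≡x = ⊥-elim (x≢y (sym y≡x))

mem : Diagram → Cell → Bool
mem T q = q ∈ᵇ T

move : Cell → Cell → Diagram → Diagram
move f t T = t ∷ remove f T

moved : Bool → Bool → Bool → Bool
moved present isTarget isSource = isTarget ∨ (present ∧ not isSource)

any-filterᵇ : ∀ {A : Set} (p e : A → Bool) (b : Bool) → (∀ y → p y ∧ e y ≡ p y ∧ b) →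
  ∀ xs → any p (filterᵇ e xs) ≡ any p xs ∧ b
any-filterᵇ p e b agree [] = refl
any-filterᵇ p e b agree (x ∷ xs) with e x in ex
... | true  with p x | trans (cong (p x ∧_) (sym ex)) (agree x)
...   | true  | refl = refl
...   | false | _    = any-filterᵇ p e b agree xs
any-filterᵇ p e b agree (x ∷ xs) | false with p x | trans (cong (p x ∧_) (sym ex)) (agree x)
...   | true  | refl = trans (any-filterᵇ p e b agree xs) (∧-zeroʳ _)
...   | false | _    = any-filterᵇ p e b agree xs

mem-remove : ∀ f T q → mem (remove f T) q ≡ mem T q ∧ not (q ≡ᵇ f)
mem-remove f T q = any-filterᵇ (q ≡ᵇ_) (λ y → not (f ≡ᵇ y)) (not (q ≡ᵇ f)) agree T
  where
  agree : ∀ y → (q ≡ᵇ y) ∧ not (f ≡ᵇ y) ≡ (q ≡ᵇ y) ∧ not (q ≡ᵇ f)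
  agree y with q ≟c y
  ... | yes refl = cong not (≡ᵇ-sym f q)
  ... | no _ = refl

mem-move : ∀ f t T q → mem (move f t T) q ≡ moved (mem T q) (q ≡ᵇ t) (q ≡ᵇ f)
mem-move f t T q = cong ((q ≡ᵇ t) ∨_) (mem-remove f T q)

-- The Boolean content of the three ways two moves can interact (see
-- `move-comm`, `move-through` and `move-refill` below).
moved-comm : ∀ m t₁ f₁ t₂ f₂ → t₂ ∧ f₁ ≡ false → t₁ ∧ f₂ ≡ false →
  moved (moved m t₁ f₁) t₂ f₂ ≡ moved (moved m t₂ f₂) t₁ f₁
moved-comm m     true  f₁    t₂    true  _  ()
moved-comm m     true  f₁    true  false _  _ = refl
moved-comm m     true  f₁    false false _  _ = refl
moved-comm m     false false true  f₂    _  _ = refl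
moved-comm m     false true  true  f₂    () _
moved-comm false false f₁    false f₂    _  _ = refl
moved-comm true  false f₁    false false _  _ = ∧-identityʳ (not f₁)
moved-comm true  false f₁    false true  _  _ = ∧-zeroʳ (not f₁)

moved-through : ∀ m x f t → x ∧ m ≡ false → moved (moved m x f) t x ≡ moved m t f
moved-through false true  f t _ = refl
moved-through m     false f t _ = cong (t ∨_) (∧-identityʳ _)

moved-refill : ∀ m x f t → x ∧ not m ≡ false → x ∧ f ≡ false → t ∧ f ≡ false →
  moved (moved m t x) x f ≡ moved m t f
moved-refill true  true  false t _  _ _ = sym (∨-zeroʳ t)
moved-refill false true  f     t () _ _
moved-refill m     true  true  t _  () _
moved-refill m     false false t _  _ _ = ∧-identityʳ _
moved-refill m     false true  false _ _ _ = trans (∧-zeroʳ _) (sym (∧-zeroʳ m))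

≡ᵇ-disjoint : ∀ q {x y} → x ≢ y → (q ≡ᵇ x) ∧ (q ≡ᵇ y) ≡ false
≡ᵇ-disjoint q {x} {y} x≢y with q ≟c x
... | yes refl = ≡ᵇ-false x≢y
... | no _ = refl

≡ᵇ-present : ∀ T q {x} → mem T x ≡ true → (q ≡ᵇ x) ∧ not (mem T q) ≡ false
≡ᵇ-present T q {x} x∈T with q ≟c x
... | yes refl = cong not x∈T
... | no _ = refl

≡ᵇ-absent : ∀ T q {x} → mem T x ≡ false → (q ≡ᵇ x) ∧ mem T q ≡ false
≡ᵇ-absent T q {x} x∉T with q ≟c x
... | yes refl = x∉T
... | no _ = refl

_≐_ : Diagram → Diagram → Set
U ≐ V = ∀ q → mem U q ≡ mem V q

mem⇒∈ : ∀ U {q} → mem U q ≡ true → q ∈ U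
mem⇒∈ (u ∷ U) {q} q∈U with q ≟c u
... | yes q≡u = here q≡u
... | no _ = there (mem⇒∈ U q∈U)

∈⇒mem : ∀ U {q} → q ∈ U → mem U q ≡ true
∈⇒mem (u ∷ U) {q} (here refl) = cong (_∨ mem U q) (≡ᵇ-refl q)
∈⇒mem (u ∷ U) {q} (there q∈U) = trans (cong ((q ≡ᵇ u) ∨_) (∈⇒mem U q∈U)) (∨-zeroʳ _)

≐⇒≋ : ∀ {U V} → U ≐ V → U ≋ V
≐⇒≋ {U} {V} U≐V q = mk⇔ (λ q∈U → mem⇒∈ V (trans (sym (U≐V q)) (∈⇒mem U q∈U)))
                        (λ q∈V → mem⇒∈ U (trans (U≐V q) (∈⇒mem V q∈V)))

mem-move² : ∀ f₁ t₁ f₂ t₂ T q → mem (move f₂ t₂ (move f₁ t₁ T)) q ≡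
  moved (moved (mem T q) (q ≡ᵇ t₁) (q ≡ᵇ f₁)) (q ≡ᵇ t₂) (q ≡ᵇ f₂)
mem-move² f₁ t₁ f₂ t₂ T q =
  trans (mem-move f₂ t₂ _ q) (cong (λ b → moved b (q ≡ᵇ t₂) (q ≡ᵇ f₂)) (mem-move f₁ t₁ T q))

move-comm : ∀ f₁ t₁ f₂ t₂ T → t₂ ≢ f₁ → t₁ ≢ f₂ →
  move f₂ t₂ (move f₁ t₁ T) ≐ move f₁ t₁ (move f₂ t₂ T)
move-comm f₁ t₁ f₂ t₂ T t₂≢f₁ t₁≢f₂ q = begin
  mem (move f₂ t₂ (move f₁ t₁ T)) q
    ≡⟨ mem-move² f₁ t₁ f₂ t₂ T q ⟩
  moved (moved (mem T q) (q ≡ᵇ t₁) (q ≡ᵇ f₁)) (q ≡ᵇ t₂) (q ≡ᵇ f₂)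
    ≡⟨ moved-comm (mem T q) (q ≡ᵇ t₁) (q ≡ᵇ f₁) (q ≡ᵇ t₂) (q ≡ᵇ f₂)
                  (≡ᵇ-disjoint q t₂≢f₁) (≡ᵇ-disjoint q t₁≢f₂) ⟩
  moved (moved (mem T q) (q ≡ᵇ t₂) (q ≡ᵇ f₂)) (q ≡ᵇ t₁) (q ≡ᵇ f₁)
    ≡⟨ mem-move² f₂ t₂ f₁ t₁ T q ⟨
  mem (move f₁ t₁ (move f₂ t₂ T)) q ∎
  where open ≡-Reasoning

move-through : ∀ f x t T → mem T x ≡ false → move x t (move f x T) ≐ move f t T
move-through f x t T x∉T q = trans (mem-move² f x x t T q)
  (trans (moved-through (mem T q) (q ≡ᵇ x) (q ≡ᵇ f) (q ≡ᵇ t) (≡ᵇ-absent T q x∉T)) (sym (mem-move f t T q)))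

move-refill : ∀ f x t T → mem T x ≡ true → x ≢ f → t ≢ f → move f x (move x t T) ≐ move f t T
move-refill f x t T x∈T x≢f t≢f q = trans (mem-move² x t f x T q)
  (trans (moved-refill (mem T q) (q ≡ᵇ x) (q ≡ᵇ f) (q ≡ᵇ t)
                       (≡ᵇ-present T q x∈T) (≡ᵇ-disjoint q x≢f) (≡ᵇ-disjoint q t≢f))
         (sym (mem-move f t T q)))

mem-move-other : ∀ f t T {q} → q ≢ t → q ≢ f → mem (move f t T) q ≡ mem T q
mem-move-other f t T {q} q≢t q≢f = trans (mem-move f t T q)
  (trans (cong₂ (λ a b → a ∨ (mem T q ∧ not b)) (≡ᵇ-false q≢t) (≡ᵇ-false q≢f)) (∧-identityʳ _))

mem-move-target : ∀ f t T → mem (move f t T) t ≡ true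
mem-move-target f t T = cong (_∨ mem (remove f T) t) (≡ᵇ-refl t)

mem-move-source : ∀ f t T → f ≢ t → mem (move f t T) f ≡ false
mem-move-source f t T f≢t = trans (mem-move f t T f)
  (trans (cong₂ (λ a b → a ∨ (mem T f ∧ not b)) (≡ᵇ-false f≢t) (≡ᵇ-refl f)) (∧-zeroʳ _))

-- The state is the number of pending
-- unpaired cells of the lower row together with the column of the rightmost
-- unpaired cell of the upper row found so far; `lo`/`up` tell whether a
-- column has a cell in the lower/upper row.
RowState : Set
RowState = ℕ × Maybe ℕ

rowStep′ : Bool → Bool → ℕ → RowState → RowState
rowStep′ true  true  x s           = s
rowStep′ true  false x (k , l)     = (suc k , l)
rowStep′ false true  x (zero , l)  = (zero , just x)
rowStep′ false true  x (suc k , l) = (k , l)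
rowStep′ false false x s           = s

rowFold : (lo up : ℕ → Bool) → List ℕ → RowState → RowState
rowFold lo up []       s = s
rowFold lo up (x ∷ xs) s = rowFold lo up xs (rowStep′ (lo x) (up x) x s)

inRow : Diagram → ℕ → ℕ → Bool
inRow T i x = mem T (x , i)

inCol : Diagram → ℕ → ℕ → Bool
inCol T c y = mem T (c , y)

rowScan≡rowFold : ∀ i T xs k l →
  rowScan i T xs k l ≡ proj₂ (rowFold (inRow T i) (inRow T (suc i)) xs (k , l))
rowScan≡rowFold i T [] k l = refl
rowScan≡rowFold i T (x ∷ xs) k l with (x , i) ∈ᵇ T | (x , suc i) ∈ᵇ T
... | true  | true  = rowScan≡rowFold i T xs k l
... | true  | false = rowScan≡rowFold i T xs (suc k) l
... | false | false = rowScan≡rowFold i T xs k l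
... | false | true with k
...   | zero   = rowScan≡rowFold i T xs zero (just x)
...   | suc k′ = rowScan≡rowFold i T xs k′ l

-- The column c-pairing as a left fold.  The state is the stack of rows of
-- pending unpaired cells of the right column, most recent first.
pop : List ℕ → List ℕ
pop []       = []
pop (_ ∷ st) = st

colStep′ : Bool → Bool → ℕ → List ℕ → List ℕ
colStep′ true  true  y st = st
colStep′ false true  y st = y ∷ st
colStep′ true  false y st = pop st
colStep′ false false y st = st

colFold : (left right : ℕ → Bool) → List ℕ → List ℕ → List ℕ
colFold left right []       st = st
colFold left right (y ∷ ys) st = colFold left right ys (colStep′ (left y) (right y) y st)

colScan≡colFold : ∀ c T ys st → colScan c T ys st ≡ colFold (inCol T c) (inCol T (suc c)) ys st
colScan≡colFold c T [] st = refl
colScan≡colFold c T (y ∷ ys) st with (c , y) ∈ᵇ T | (suc c , y) ∈ᵇ T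
... | true  | true  = colScan≡colFold c T ys st
... | false | true  = colScan≡colFold c T ys (y ∷ st)
... | false | false = colScan≡colFold c T ys st
... | true  | false with st
...   | []      = colScan≡colFold c T ys []
...   | _ ∷ st′ = colScan≡colFold c T ys st′

pop-within : ∀ {Q : ℕ → Set} {st} → All Q st → All Q (pop st)
pop-within []        = []
pop-within (_ ∷ qst) = qst

colStep-within : ∀ {Q : ℕ → Set} a b {y st} → Q y → All Q st → All Q (colStep′ a b y st)
colStep-within true  true  qy qst = qst
colStep-within false true  qy qst = qy ∷ qst
colStep-within true  false qy qst = pop-within qst
colStep-within false false qy qst = qst

-- Facts about both folds for arbitrary bit functions (for the column fold,
-- `lo`/`up` play the role of the left/right column).
module _ (lo up : ℕ → Bool) where

  rowFold-++ : ∀ xs ys s → rowFold lo up (xs ++ ys) s ≡ rowFold lo up ys (rowFold lo up xs s)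
  rowFold-++ []       ys s = refl
  rowFold-++ (x ∷ xs) ys s = rowFold-++ xs ys _

  colFold-++ : ∀ xs ys st → colFold lo up (xs ++ ys) st ≡ colFold lo up ys (colFold lo up xs st)
  colFold-++ []       ys st = refl
  colFold-++ (x ∷ xs) ys st = colFold-++ xs ys _

  Idle : List ℕ → Set
  Idle = All (λ x → lo x ≡ false × up x ≡ false)

  rowFold-idle : ∀ xs s → Idle xs → rowFold lo up xs s ≡ s
  rowFold-idle []       s []               = refl
  rowFold-idle (x ∷ xs) s ((l≡ , u≡) ∷ idle) rewrite l≡ | u≡ = rowFold-idle xs s idle

  colFold-idle : ∀ xs st → Idle xs → colFold lo up xs st ≡ st
  colFold-idle []       st []               = refl
  colFold-idle (x ∷ xs) st ((l≡ , u≡) ∷ idle) rewrite l≡ | u≡ = colFold-idle xs st idle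

  rowFound : List ℕ → ℕ → Maybe ℕ
  rowFound xs k = proj₂ (rowFold lo up xs (k , nothing))

  rowFold-found : ∀ xs k l → proj₂ (rowFold lo up xs (k , l)) ≡ rowFound xs k <∣> l
  rowFold-found []       k l = refl
  rowFold-found (x ∷ xs) k l with lo x | up x
  ... | true  | true  = rowFold-found xs k l
  ... | true  | false = rowFold-found xs (suc k) l
  ... | false | false = rowFold-found xs k l
  ... | false | true with k
  ...   | suc k′ = rowFold-found xs k′ l
  ...   | zero   = begin
    proj₂ (rowFold lo up xs (zero , just x))   ≡⟨ rowFold-found xs zero (just x) ⟩
    rowFound xs zero <∣> just x                ≡⟨ <∣>-assoc (rowFound xs zero) ⟩
    (rowFound xs zero <∣> just x) <∣> l        ≡⟨ cong (_<∣> l) (rowFold-found xs zero (just x)) ⟨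
    proj₂ (rowFold lo up xs (zero , just x)) <∣> l ∎
    where
    open ≡-Reasoning
    <∣>-assoc : ∀ (a : Maybe ℕ) → a <∣> just x ≡ (a <∣> just x) <∣> l
    <∣>-assoc (just _) = refl
    <∣>-assoc nothing  = refl

  rowFold-within : ∀ {Q : ℕ → Set} xs k l → All Q xs → (∀ {z} → l ≡ just z → Q z) →
    ∀ {z} → proj₂ (rowFold lo up xs (k , l)) ≡ just z → Q z
  rowFold-within []       k l []         ql = ql
  rowFold-within (x ∷ xs) k l (qx ∷ qxs) ql with lo x | up x
  ... | true  | true  = rowFold-within xs k l qxs ql
  ... | true  | false = rowFold-within xs (suc k) l qxs ql
  ... | false | false = rowFold-within xs k l qxs ql
  ... | false | true with k
  ...   | suc k′ = rowFold-within xs k′ l qxs ql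
  ...   | zero   = rowFold-within xs zero (just x) qxs (λ { refl → qx })

  rowFound-within : ∀ {Q : ℕ → Set} xs k → All Q xs → ∀ {z} → rowFound xs k ≡ just z → Q z
  rowFound-within xs k qxs = rowFold-within xs k nothing qxs (λ ())

  colFold-within : ∀ {Q : ℕ → Set} ys st → All Q ys → All Q st → All Q (colFold lo up ys st)
  colFold-within []       st []         qst = qst
  colFold-within (y ∷ ys) st (qy ∷ qys) qst =
    colFold-within ys _ qys (colStep-within (lo y) (up y) qy qst)

  -- The number of entries of the initial stack that scanning ys pops.
  pops : List ℕ → ℕ
  pops []       = 0
  pops (y ∷ ys) = popStep (lo y) (up y) (pops ys)
    where
    popStep : Bool → Bool → ℕ → ℕ
    popStep false true  p = p ∸ 1
    popStep true  false p = suc p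
    popStep _     _     p = p

  colFold-split : ∀ ys st → colFold lo up ys st ≡ colFold lo up ys [] ++ drop (pops ys) st
  colFold-split [] st = refl
  colFold-split (y ∷ ys) st with lo y | up y
  ... | true  | true  = colFold-split ys st
  ... | false | false = colFold-split ys st
  ... | true  | false with st
  ...   | []      = sym (++-identityʳ _)
  ...   | _ ∷ st′ = colFold-split ys st′
  colFold-split (y ∷ ys) st | false | true = begin
    colFold lo up ys (y ∷ st)                    ≡⟨ colFold-split ys (y ∷ st) ⟩
    S ++ drop p (y ∷ st)                         ≡⟨ cong (S ++_) (drop-∷ p st) ⟩
    S ++ (drop p (y ∷ []) ++ drop (p ∸ 1) st)    ≡⟨ ++-assoc S _ _ ⟨
    (S ++ drop p (y ∷ [])) ++ drop (p ∸ 1) st    ≡⟨ cong (_++ drop (p ∸ 1) st) (colFold-split ys (y ∷ [])) ⟨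
    colFold lo up ys (y ∷ []) ++ drop (p ∸ 1) st ∎
    where
    open ≡-Reasoning
    S = colFold lo up ys []
    p = pops ys
    drop-∷ : ∀ p st → drop p (y ∷ st) ≡ drop p (y ∷ []) ++ drop (p ∸ 1) st
    drop-∷ zero          st = refl
    drop-∷ (suc zero)    st = refl
    drop-∷ (suc (suc p)) st = refl

Agree : (lo up lo′ up′ : ℕ → Bool) → List ℕ → Set
Agree lo up lo′ up′ = All (λ x → lo x ≡ lo′ x × up x ≡ up′ x)

rowFold-cong : ∀ lo up lo′ up′ xs s → Agree lo up lo′ up′ xs → rowFold lo up xs s ≡ rowFold lo′ up′ xs s
rowFold-cong lo up lo′ up′ []       s []                 = refl
rowFold-cong lo up lo′ up′ (x ∷ xs) s ((l≡ , u≡) ∷ agree) rewrite l≡ | u≡ =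
  rowFold-cong lo up lo′ up′ xs _ agree

colFold-cong : ∀ lo up lo′ up′ ys st → Agree lo up lo′ up′ ys → colFold lo up ys st ≡ colFold lo′ up′ ys st
colFold-cong lo up lo′ up′ []       st []                 = refl
colFold-cong lo up lo′ up′ (y ∷ ys) st ((l≡ , u≡) ∷ agree) rewrite l≡ | u≡ =
  colFold-cong lo up lo′ up′ ys _ agree

pops-cong : ∀ lo up lo′ up′ ys → Agree lo up lo′ up′ ys → pops lo up ys ≡ pops lo′ up′ ys
pops-cong lo up lo′ up′ []       []                 = refl
pops-cong lo up lo′ up′ (y ∷ ys) ((l≡ , u≡) ∷ agree)
  rewrite l≡ | u≡ | pops-cong lo up lo′ up′ ys agree = refl

Bounded : ℕ → Diagram → Set
Bounded n U = ∀ {x y} → mem U (x , y) ≡ true → x < n × y < n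

bounded-by-bound : ∀ U → Bounded (suc (bound U)) U
bounded-by-bound (u ∷ U) {x} {y} xy∈U with (x , y) ≟c u
... | yes refl = s≤s (≤-trans (m≤m⊔n x y) (m≤m⊔n (x ⊔ y) (bound U))) ,
                 s≤s (≤-trans (m≤n⊔m x y) (m≤m⊔n (x ⊔ y) (bound U)))
... | no _ with bounded-by-bound U xy∈U
...   | x< , y< = <-≤-trans x< (s≤s (m≤n⊔m _ (bound U))) , <-≤-trans y< (s≤s (m≤n⊔m _ (bound U)))

Bounded-mono : ∀ {m n} U → m ≤ n → Bounded m U → Bounded n U
Bounded-mono U m≤n bd xy∈U = <-≤-trans (proj₁ (bd xy∈U)) m≤n , <-≤-trans (proj₂ (bd xy∈U)) m≤n

Bounded-move : ∀ {n} f t T → Bounded n T → proj₁ t < n → proj₂ t < n → Bounded n (move f t T)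
Bounded-move f t T bd t₁< t₂< {x} {y} xy∈ with (x , y) ≟c t | mem-move f t T (x , y)
... | yes refl | _ = t₁< , t₂<
... | no _ | eq with mem T (x , y) in xy∈T
...   | true  = bd xy∈T
...   | false with () ← trans (sym xy∈) eq

Vanish : ℕ → (ℕ → Bool) → (ℕ → Bool) → Set
Vanish m lo up = ∀ {x} → m ≤ x → lo x ≡ false × up x ≡ false

applyUpTo-+ : ∀ (f : ℕ → ℕ) m d → applyUpTo f (m + d) ≡ applyUpTo f m ++ applyUpTo (λ i → f (m + i)) d
applyUpTo-+ f zero    d = refl
applyUpTo-+ f (suc m) d = cong (f 0 ∷_) (applyUpTo-+ (λ i → f (suc i)) m d)

upTo-extend : ∀ {m n} → m ≤ n → upTo n ≡ upTo m ++ applyUpTo (m +_) (n ∸ m)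
upTo-extend {m} {n} m≤n = trans (cong upTo (sym (m+[n∸m]≡n m≤n))) (applyUpTo-+ (λ i → i) m (n ∸ m))

extension-idle : ∀ {m lo up} → Vanish m lo up → ∀ d → Idle lo up (applyUpTo (m +_) d)
extension-idle {m} vanish d = applyUpTo⁺₁ (m +_) d (λ {i} _ → vanish (m≤m+n m i))

rowFold-extend : ∀ {m n lo up} → m ≤ n → Vanish m lo up → ∀ s →
  rowFold lo up (upTo n) s ≡ rowFold lo up (upTo m) s
rowFold-extend {m} {n} {lo} {up} m≤n vanish s
  rewrite upTo-extend m≤n | rowFold-++ lo up (upTo m) (applyUpTo (m +_) (n ∸ m)) s =
  rowFold-idle lo up _ _ (extension-idle vanish (n ∸ m))

colFold-extend : ∀ {m n lo up} → m ≤ n → Vanish m lo up → ∀ st →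
  colFold lo up (upTo n) st ≡ colFold lo up (upTo m) st
colFold-extend {m} {n} {lo} {up} m≤n vanish st
  rewrite upTo-extend m≤n | colFold-++ lo up (upTo m) (applyUpTo (m +_) (n ∸ m)) st =
  colFold-idle lo up _ _ (extension-idle vanish (n ∸ m))

absent-past-col : ∀ {n} U → Bounded n U → ∀ {x} y → n ≤ x → mem U (x , y) ≡ false
absent-past-col U bd {x} y n≤x with mem U (x , y) in xy∈U
... | false = refl
... | true  = ⊥-elim (<-irrefl refl (<-≤-trans (proj₁ (bd xy∈U)) n≤x))

absent-past-row : ∀ {n} U → Bounded n U → ∀ x {y} → n ≤ y → mem U (x , y) ≡ false
absent-past-row U bd x {y} n≤y with mem U (x , y) in xy∈U
... | false = refl
... | true  = ⊥-elim (<-irrefl refl (<-≤-trans (proj₂ (bd xy∈U)) n≤y))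

vanish-rows : ∀ {n} U i → Bounded n U → Vanish n (inRow U i) (inRow U (suc i))
vanish-rows U i bd n≤x = absent-past-col U bd i n≤x , absent-past-col U bd (suc i) n≤x

vanish-cols : ∀ {n} U c → Bounded n U → Vanish n (inCol U c) (inCol U (suc c))
vanish-cols U c bd n≤y = absent-past-row U bd c n≤y , absent-past-row U bd (suc c) n≤y

rightmostUnpaired-upTo : ∀ {n} i U → Bounded n U →
  rightmostUnpaired i U ≡ proj₂ (rowFold (inRow U i) (inRow U (suc i)) (upTo n) (0 , nothing))
rightmostUnpaired-upTo {n} i U bd with ≤-total (suc (bound U)) n
... | inj₁ b≤n = trans (rowScan≡rowFold i U (range U) 0 nothing)
  (cong proj₂ (sym (rowFold-extend b≤n (vanish-rows U i (bounded-by-bound U)) _)))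
... | inj₂ n≤b = trans (rowScan≡rowFold i U (range U) 0 nothing)
  (cong proj₂ (rowFold-extend n≤b (vanish-rows U i bd) _))

lowestUnpaired-upTo : ∀ {n} c U → Bounded n U →
  lowestUnpaired c U ≡ last (colFold (inCol U c) (inCol U (suc c)) (upTo n) [])
lowestUnpaired-upTo {n} c U bd with ≤-total (suc (bound U)) n
... | inj₁ b≤n = cong last (trans (colScan≡colFold c U (range U) [])
  (sym (colFold-extend b≤n (vanish-cols U c (bounded-by-bound U)) _)))
... | inj₂ n≤b = cong last (trans (colScan≡colFold c U (range U) [])
  (colFold-extend n≤b (vanish-cols U c bd) _))

pastBlock : ℕ → ℕ → List ℕ
pastBlock c M = applyUpTo (λ i → c + (2 + i)) M

upTo-block : ∀ c M → upTo (c + (2 + M)) ≡ upTo c ++ c ∷ suc c ∷ pastBlock c M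
upTo-block c M = trans (applyUpTo-+ (λ i → i) c (2 + M))
  (cong (upTo c ++_) (cong₂ (λ x y → x ∷ y ∷ pastBlock c M) (+-identityʳ c) (+-comm c 1)))

pastBlock-past : ∀ c M → All (suc c <_) (pastBlock c M)
pastBlock-past c M = applyUpTo⁺₁ _ M (λ {i} _ → subst (suc c <_) (sym (+-suc c (suc i)))
  (s≤s (subst (suc c ≤_) (sym (+-suc c i)) (s≤s (m≤m+n c i)))))

data Step (from to : ℕ) (old new : Maybe ℕ) : Set where
  stays : new ≡ old → old ≢ just from → Step from to old new
  jumps : old ≡ just from → new ≡ just to → Step from to old new

-- The row scan around the block of columns c, c+1.  The columns past the
-- block are summarised by g: from k pending lower cells they report g k,
-- which always lies past the block.
module RowBlock (c : ℕ) (g : ℕ → Maybe ℕ) (g-past : ∀ {k z} → g k ≡ just z → suc c < z) where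

  rowBlock : (a₀ b₀ a₁ b₁ : Bool) → RowState → RowState
  rowBlock a₀ b₀ a₁ b₁ s = rowStep′ a₁ b₁ (suc c) (rowStep′ a₀ b₀ c s)

  rowEnd : RowState → Maybe ℕ
  rowEnd (k , l) = g k <∣> l

  Before : Maybe ℕ → Set
  Before l = ∀ {z} → l ≡ just z → z < c

  end-in-block : ∀ k l {z} → g k <∣> l ≡ just z → z ≤ suc c → l ≡ just z
  end-in-block k l e z≤ with g k in gk
  ... | nothing = e
  ... | just w with refl ← e = ⊥-elim (<-irrefl refl (<-≤-trans (g-past gk) z≤))

  end≢c : ∀ k {l} → l ≢ just c → g k <∣> l ≢ just c
  end≢c k {l} l≢c e = l≢c (end-in-block k l e (n≤1+n c))

  end≢c+1 : ∀ k {l} → l ≢ just (suc c) → g k <∣> l ≢ just (suc c)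
  end≢c+1 k {l} l≢c+1 e = l≢c+1 (end-in-block k l e ≤-refl)

  before≢c : ∀ {l} → Before l → l ≢ just c
  before≢c before e = <-irrefl refl (before e)

  before≢c+1 : ∀ {l} → Before l → l ≢ just (suc c)
  before≢c+1 before e = <-irrefl refl (<-trans (before e) (n<1+n c))

  step-answer : ∀ a b x s → proj₂ (rowStep′ a b x s) ≡ proj₂ s ⊎
    (a ≡ false × b ≡ true × proj₁ s ≡ 0 × rowStep′ a b x s ≡ (0 , just x))
  step-answer true  true  x s           = inj₁ refl
  step-answer true  false x s           = inj₁ refl
  step-answer false false x s           = inj₁ refl
  step-answer false true  x (zero , l)  = inj₂ (refl , refl , refl , refl)
  step-answer false true  x (suc k , l) = inj₁ refl

  ends-at-c : ∀ a₀ b₀ a₁ b₁ k₀ {l₀} → Before l₀ →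
    rowEnd (rowBlock a₀ b₀ a₁ b₁ (k₀ , l₀)) ≡ just c → b₀ ≡ true × a₀ ≡ false × (b₁ ≡ true → a₁ ≡ true)
  ends-at-c a₀ b₀ a₁ b₁ k₀ {l₀} before e
    with end-in-block (proj₁ (rowBlock a₀ b₀ a₁ b₁ (k₀ , l₀))) _ e (n≤1+n c)
  ... | l≡c with step-answer a₁ b₁ (suc c) (rowStep′ a₀ b₀ c (k₀ , l₀))
  ...   | inj₂ (_ , _ , _ , e₁) rewrite e₁ = ⊥-elim (1+n≢n (just-injective l≡c))
  ...   | inj₁ e₁ with step-answer a₀ b₀ c (k₀ , l₀)
  ...     | inj₁ e₀ = ⊥-elim (before≢c before (trans (sym e₀) (trans (sym e₁) l≡c)))
  ...     | inj₂ (refl , refl , refl , e₀) rewrite e₀ with a₁ | b₁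
  ...       | true  | true  = refl , refl , λ _ → refl
  ...       | true  | false = refl , refl , λ ()
  ...       | false | false = refl , refl , λ ()
  ...       | false | true  = ⊥-elim (1+n≢n (just-injective l≡c))

  ends-at-c+1 : ∀ a₀ b₀ a₁ b₁ k₀ {l₀} → Before l₀ →
    rowEnd (rowBlock a₀ b₀ a₁ b₁ (k₀ , l₀)) ≡ just (suc c) → b₁ ≡ true × a₁ ≡ false × (a₀ ≡ true → b₀ ≡ true)
  ends-at-c+1 a₀ b₀ a₁ b₁ k₀ {l₀} before e
    with end-in-block (proj₁ (rowBlock a₀ b₀ a₁ b₁ (k₀ , l₀))) _ e ≤-refl
  ... | l≡c+1 with step-answer a₁ b₁ (suc c) (rowStep′ a₀ b₀ c (k₀ , l₀))
  ...   | inj₁ e₁ with step-answer a₀ b₀ c (k₀ , l₀)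
  ...     | inj₁ e₀ = ⊥-elim (before≢c+1 before (trans (sym e₀) (trans (sym e₁) l≡c+1)))
  ...     | inj₂ (_ , _ , _ , e₀) rewrite e₀ = ⊥-elim (1+n≢n (sym (just-injective (trans (sym e₁) l≡c+1))))
  ends-at-c+1 a₀ b₀ a₁ b₁ k₀ before e | l≡c+1 | inj₂ (refl , refl , k≡0 , _) with a₀ | b₀
  ... | true  | true  = refl , refl , λ _ → refl
  ... | false | true  = refl , refl , λ ()
  ... | false | false = refl , refl , λ ()
  ... | true  | false with () ← k≡0

  -- A lower cell moving from column c+1 to column c (given b₀ → b₁).
  lower-crosses : ∀ b₀ b₁ k₀ {l₀} → Before l₀ → (b₀ ≡ true → b₁ ≡ true) →
    Step c (suc c) (rowEnd (rowBlock false b₀ true b₁ (k₀ , l₀))) (rowEnd (rowBlock true b₀ false b₁ (k₀ , l₀)))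
  lower-crosses false false k₀      before _ = stays refl (end≢c (suc k₀) (before≢c before))
  lower-crosses false true  k₀      before _ = stays refl (end≢c k₀ (before≢c before))
  lower-crosses true  false k₀      before b₀→b₁ with () ← b₀→b₁ refl
  lower-crosses true  true  (suc k₀) before _ = stays refl (end≢c k₀ (before≢c before))
  lower-crosses true  true  zero     before _ with g 0 in g0
  ... | just z  = stays refl (λ e → <-asym (g-past g0) (subst (_< suc c) (sym (just-injective e)) (n<1+n c)))
  ... | nothing = jumps refl refl

  -- An upper cell moving from column c+1 to column c (given a₁ → a₀).
  upper-crosses : ∀ a₀ a₁ k₀ {l₀} → Before l₀ → (a₁ ≡ true → a₀ ≡ true) →
    Step (suc c) c (rowEnd (rowBlock a₀ false a₁ true (k₀ , l₀))) (rowEnd (rowBlock a₀ true a₁ false (k₀ , l₀)))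
  upper-crosses true  true  k₀       before _ = stays refl (end≢c+1 (suc k₀) (before≢c+1 before))
  upper-crosses true  false k₀       before _ = stays refl (end≢c+1 k₀ (before≢c+1 before))
  upper-crosses false true  k₀       before a₁→a₀ with () ← a₁→a₀ refl
  upper-crosses false false (suc k₀) before _ = stays refl (end≢c+1 k₀ (before≢c+1 before))
  upper-crosses false false zero     before _ with g 0 in g0
  ... | just z  = stays refl (λ e → <-irrefl (sym (just-injective e)) (g-past g0))
  ... | nothing = jumps refl refl

step-cong : ∀ {from to old old′ new new′} → old ≡ old′ → new ≡ new′ →
  Step from to old′ new′ → Step from to old new
step-cong refl refl s = s

step-from : ∀ {from to old new} → (new ≡ old ⊎ (old ≡ just from × new ≡ just to)) → new ≢ just from →
  Step from to old new
step-from (inj₁ new≡old)          new≢ = stays new≡old (λ e → new≢ (trans new≡old e))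
step-from (inj₂ (old≡ , new≡))    _    = jumps old≡ new≡

last-within : ∀ {Q : ℕ → Set} {xs} → All Q xs → ∀ {z} → last xs ≡ just z → Q z
last-within {xs = x ∷ []}     (qx ∷ [])  refl = qx
last-within {xs = x ∷ y ∷ xs} (_ ∷ qxs) e    = last-within qxs e

last-++ : ∀ (xs : List ℕ) x st → last (xs ++ x ∷ st) ≡ last (x ∷ st)
last-++ []           x st = refl
last-++ (_ ∷ [])     x st = refl
last-++ (_ ∷ y ∷ xs) x st = last-++ (y ∷ xs) x st

-- In the column scan the answer is the bottom of the final stack A ++ drop p st.
-- Pushing x or y on the same stack gives the same answer, or the answers x and y.
bottom-push : ∀ A p x y (st : List ℕ) → last (A ++ drop p (y ∷ st)) ≡ last (A ++ drop p (x ∷ st)) ⊎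
  (last (A ++ drop p (x ∷ st)) ≡ just x × last (A ++ drop p (y ∷ st)) ≡ just y)
bottom-push A (suc _) x y st = inj₁ refl
bottom-push A zero    x y st rewrite last-++ A x st | last-++ A y st with st
... | []    = inj₂ (refl , refl)
... | _ ∷ _ = inj₁ refl

bottom-covered : ∀ A p x y (st : List ℕ) → last (A ++ drop p (x ∷ y ∷ st)) ≡ last (A ++ drop (p ∸ 1) (y ∷ st))
bottom-covered A (suc _) x y st = refl
bottom-covered A zero    x y st = trans (last-++ A x (y ∷ st)) (sym (last-++ A y st))

-- The column scan around the block of rows r, r+1.  The rows past the block
-- are summarised by the stack A they leave from an empty stack and the number
-- p of entries they consume; A lies past the block, and the stack st₀ left by
-- the rows before the block lies before it.
module ColBlock (r : ℕ) (A : List ℕ) (p : ℕ) (A-past : All (suc r <_) A)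
                (st₀ : List ℕ) (st₀-before : All (_< r) st₀) where

  colBlock : (a₀ a₁ b₀ b₁ : Bool) → List ℕ → List ℕ
  colBlock a₀ a₁ b₀ b₁ st = colStep′ b₀ b₁ (suc r) (colStep′ a₀ a₁ r st)

  colEnd : List ℕ → Maybe ℕ
  colEnd st = last (A ++ drop p st)

  colEnd-within : ∀ {Q : ℕ → Set} → All Q A → ∀ {st} → All Q st → ∀ {z} → colEnd st ≡ just z → Q z
  colEnd-within qA {st} qst = last-within (++⁺ qA (drop⁺ p qst))

  A≢r : All (_≢ r) A
  A≢r = All.map (λ r+1< e → <-asym (subst (suc r <_) e r+1<) (n<1+n r)) A-past
  A≢r+1 : All (_≢ suc r) A
  A≢r+1 = All.map (λ r+1< e → <-irrefl (sym e) r+1<) A-past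
  st₀≢r : All (_≢ r) st₀
  st₀≢r = All.map (λ <r e → <-irrefl e <r) st₀-before
  st₀≢r+1 : All (_≢ suc r) st₀
  st₀≢r+1 = All.map (λ <r e → <-irrefl e (<-trans <r (n<1+n r))) st₀-before

  r+1≢r : suc r ≢ r
  r+1≢r = 1+n≢n
  r≢r+1 : r ≢ suc r
  r≢r+1 e = 1+n≢n (sym e)

  end≢r : ∀ {st} → All (_≢ r) st → colEnd st ≢ just r
  end≢r qst e = colEnd-within A≢r qst e refl
  end≢r+1 : ∀ {st} → All (_≢ suc r) st → colEnd st ≢ just (suc r)
  end≢r+1 qst e = colEnd-within A≢r+1 qst e refl

  ends-at-r : ∀ a₀ a₁ b₀ b₁ → colEnd (colBlock a₀ a₁ b₀ b₁ st₀) ≡ just r →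
    a₀ ≡ false × a₁ ≡ true × (b₀ ≡ true → b₁ ≡ true)
  ends-at-r true  true  b₀ b₁ e = ⊥-elim (end≢r (colStep-within b₀ b₁ r+1≢r st₀≢r) e)
  ends-at-r false false b₀ b₁ e = ⊥-elim (end≢r (colStep-within b₀ b₁ r+1≢r st₀≢r) e)
  ends-at-r true  false b₀ b₁ e = ⊥-elim (end≢r (colStep-within b₀ b₁ r+1≢r (pop-within st₀≢r)) e)
  ends-at-r false true  true  false e = ⊥-elim (end≢r st₀≢r e)
  ends-at-r false true  true  true  e = refl , refl , λ _ → refl
  ends-at-r false true  false b₁    e = refl , refl , λ ()

  ends-at-r+1 : ∀ a₀ a₁ b₀ b₁ → colEnd (colBlock a₀ a₁ b₀ b₁ st₀) ≡ just (suc r) →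
    b₀ ≡ false × b₁ ≡ true × (a₁ ≡ true → a₀ ≡ true)
  ends-at-r+1 a₀ a₁ true true  e = ⊥-elim (end≢r+1 (colStep-within a₀ a₁ r≢r+1 st₀≢r+1) e)
  ends-at-r+1 a₀ a₁ false false e = ⊥-elim (end≢r+1 (colStep-within a₀ a₁ r≢r+1 st₀≢r+1) e)
  ends-at-r+1 a₀ a₁ true false e = ⊥-elim (end≢r+1 (pop-within (colStep-within a₀ a₁ r≢r+1 st₀≢r+1)) e)
  ends-at-r+1 false true  false true e =
    ⊥-elim (last-within (++⁺ A≢r+1 (drop⁺ (p ∸ 1) (r≢r+1 ∷ st₀≢r+1)))
                        (trans (sym (bottom-covered A p (suc r) r st₀)) e) refl)
  ends-at-r+1 false false false true e = refl , refl , λ ()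
  ends-at-r+1 true  a₁    false true e = refl , refl , λ _ → refl

  -- A left cell moving from row r+1 to row r (given b₁ → a₁).
  left-crosses : ∀ a₁ b₁ → (b₁ ≡ true → a₁ ≡ true) →
    Step r (suc r) (colEnd (colBlock false a₁ true b₁ st₀)) (colEnd (colBlock true a₁ false b₁ st₀))
  left-crosses false false _ = stays refl (end≢r (pop-within st₀≢r))
  left-crosses false true  b₁→a₁ with () ← b₁→a₁ refl
  left-crosses true  false _ = stays refl (end≢r st₀≢r)
  left-crosses true  true  _ = step-from (bottom-push A p r (suc r) st₀) (end≢r (r+1≢r ∷ st₀≢r))

  -- A right cell moving from row r+1 to row r (given a₀ → b₀).
  right-crosses : ∀ a₀ b₀ → (a₀ ≡ true → b₀ ≡ true) →
    Step (suc r) r (colEnd (colBlock a₀ false b₀ true st₀)) (colEnd (colBlock a₀ true b₀ false st₀))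
  right-crosses false false _ = step-from (bottom-push A p (suc r) r st₀) (end≢r+1 (r≢r+1 ∷ st₀≢r+1))
  right-crosses false true  _ = stays refl (end≢r+1 st₀≢r+1)
  right-crosses true  false a₀→b₀ with () ← a₀→b₀ refl
  right-crosses true  true  _ = stays refl (end≢r+1 (pop-within st₀≢r+1))

-- Normal forms of both scans of T and of any diagram that agrees with T
-- outside the 2×2 block of columns c, c+1 and rows r, r+1: each is the fixed
-- scan of T before the block, then the block, then the fixed scan of T past it.
module LocalForm (T : Diagram) (r c : ℕ) where

  -- Past the bound of T (and of the moves considered below).
  M : ℕ
  M = suc (bound T)

  lowT upT leftT rightT : ℕ → Bool
  lowT   = inRow T r
  upT    = inRow T (suc r)
  leftT  = inCol T c
  rightT = inCol T (suc c)

  rowBound colBound : ℕ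
  rowBound = c + (2 + M)
  colBound = r + (2 + M)

  s₀ : RowState
  s₀ = rowFold lowT upT (upTo c) (0 , nothing)

  open RowBlock c (rowFound lowT upT (pastBlock c M))
                  (λ {k} → rowFound-within lowT upT (pastBlock c M) k (pastBlock-past c M)) public

  before₀ : Before (proj₂ s₀)
  before₀ = rowFold-within lowT upT (upTo c) 0 nothing (all-upTo c) (λ ())

  st₀ : List ℕ
  st₀ = colFold leftT rightT (upTo r) []

  open ColBlock r (colFold leftT rightT (pastBlock r M) []) (pops leftT rightT (pastBlock r M))
                  (colFold-within leftT rightT (pastBlock r M) [] (pastBlock-past r M) [])
                  st₀ (colFold-within leftT rightT (upTo r) [] (all-upTo r) []) public

  RowAgree : Diagram → Set
  RowAgree U = ∀ {x} → x ≢ c → x ≢ suc c → inRow U r x ≡ lowT x × inRow U (suc r) x ≡ upT x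

  ColAgree : Diagram → Set
  ColAgree U = ∀ {y} → y ≢ r → y ≢ suc r → inCol U c y ≡ leftT y × inCol U (suc c) y ≡ rightT y

  rowForm : ∀ U → Bounded rowBound U → RowAgree U →
    rightmostUnpaired r U ≡
      rowEnd (rowBlock (inRow U r c) (inRow U (suc r) c) (inRow U r (suc c)) (inRow U (suc r) (suc c)) s₀)
  rowForm U bd agree = begin
    rightmostUnpaired r U
      ≡⟨ rightmostUnpaired-upTo r U bd ⟩
    proj₂ (rowFold lo up (upTo rowBound) (0 , nothing))
      ≡⟨ cong (λ xs → proj₂ (rowFold lo up xs (0 , nothing))) (upTo-block c M) ⟩
    proj₂ (rowFold lo up (upTo c ++ c ∷ suc c ∷ past) (0 , nothing))
      ≡⟨ cong proj₂ (rowFold-++ lo up (upTo c) (c ∷ suc c ∷ past) (0 , nothing)) ⟩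
    proj₂ (rowFold lo up past (block (rowFold lo up (upTo c) (0 , nothing))))
      ≡⟨ cong (λ s → proj₂ (rowFold lo up past (block s)))
              (rowFold-cong lo up lowT upT (upTo c) _ agree-before) ⟩
    proj₂ (rowFold lo up past (block s₀))
      ≡⟨ rowFold-found lo up past _ _ ⟩
    rowFound lo up past (proj₁ (block s₀)) <∣> proj₂ (block s₀)
      ≡⟨ cong (λ s → proj₂ s <∣> proj₂ (block s₀)) (rowFold-cong lo up lowT upT past _ agree-past) ⟩
    rowEnd (block s₀) ∎
    where
    open ≡-Reasoning
    lo up : ℕ → Bool
    lo = inRow U r
    up = inRow U (suc r)
    past = pastBlock c M
    block = rowBlock (lo c) (up c) (lo (suc c)) (up (suc c))
    agree-before : Agree lo up lowT upT (upTo c)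
    agree-before = All.map (λ x<c → agree (<⇒≢ x<c) (<⇒≢ (<-trans x<c (n<1+n c)))) (all-upTo c)
    agree-past : Agree lo up lowT upT past
    agree-past = All.map (λ c+1<x → agree (>⇒≢ (<-trans (n<1+n c) c+1<x)) (>⇒≢ c+1<x)) (pastBlock-past c M)

  colForm : ∀ U → Bounded colBound U → ColAgree U →
    lowestUnpaired c U ≡
      colEnd (colBlock (inCol U c r) (inCol U (suc c) r) (inCol U c (suc r)) (inCol U (suc c) (suc r)) st₀)
  colForm U bd agree = begin
    lowestUnpaired c U
      ≡⟨ lowestUnpaired-upTo c U bd ⟩
    last (colFold lf rt (upTo colBound) [])
      ≡⟨ cong (λ ys → last (colFold lf rt ys [])) (upTo-block r M) ⟩
    last (colFold lf rt (upTo r ++ r ∷ suc r ∷ past) [])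
      ≡⟨ cong last (colFold-++ lf rt (upTo r) (r ∷ suc r ∷ past) []) ⟩
    last (colFold lf rt past (block (colFold lf rt (upTo r) [])))
      ≡⟨ cong (λ st → last (colFold lf rt past (block st)))
              (colFold-cong lf rt leftT rightT (upTo r) [] agree-before) ⟩
    last (colFold lf rt past (block st₀))
      ≡⟨ cong last (colFold-split lf rt past (block st₀)) ⟩
    last (colFold lf rt past [] ++ drop (pops lf rt past) (block st₀))
      ≡⟨ cong₂ (λ A p → last (A ++ drop p (block st₀)))
               (colFold-cong lf rt leftT rightT past [] agree-past) (pops-cong lf rt leftT rightT past agree-past) ⟩
    colEnd (block st₀) ∎
    where
    open ≡-Reasoning
    lf rt : ℕ → Bool
    lf = inCol U c
    rt = inCol U (suc c)
    past = pastBlock r M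
    block = colBlock (lf r) (rt r) (lf (suc r)) (rt (suc r))
    agree-before : Agree lf rt leftT rightT (upTo r)
    agree-before = All.map (λ y<r → agree (<⇒≢ y<r) (<⇒≢ (<-trans y<r (n<1+n r)))) (all-upTo r)
    agree-past : Agree lf rt leftT rightT past
    agree-past = All.map (λ r+1<y → agree (>⇒≢ (<-trans (n<1+n r) r+1<y)) (>⇒≢ r+1<y)) (pastBlock-past r M)

-- A cell
-- at position p crosses the block; the answer, a position of the other kind,
-- stays unchanged (and then it was not the one the crossing could affect), or
-- moves from j to j+1 when p = i, or from j+1 to j when p = i+1.
data Shift (i j p : ℕ) (old new : Maybe ℕ) : Set where
  same : new ≡ old → ¬ (p ≡ i × old ≡ just j) → ¬ (p ≡ suc i × old ≡ just (suc j)) → Shift i j p old new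
  inc  : p ≡ i → old ≡ just j → new ≡ just (suc j) → Shift i j p old new
  dec  : p ≡ suc i → old ≡ just (suc j) → new ≡ just j → Shift i j p old new

shift-at : ∀ {i j old new} → Step j (suc j) old new → Shift i j i old new
shift-at (stays new≡old old≢j) =
  same new≡old (λ (_ , old≡j) → old≢j old≡j) (λ (i≡i+1 , _) → n≢1+n _ i≡i+1)
shift-at (jumps old≡j new≡j+1) = inc refl old≡j new≡j+1

shift-at-suc : ∀ {i j old new} → Step (suc j) j old new → Shift i j (suc i) old new
shift-at-suc (stays new≡old old≢j+1) =
  same new≡old (λ (i+1≡i , _) → 1+n≢n i+1≡i) (λ (_ , old≡j+1) → old≢j+1 old≡j+1)
shift-at-suc (jumps old≡j+1 new≡j) = dec refl old≡j+1 new≡j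

shift-away : ∀ {i j p old new} → p ≢ i → p ≢ suc i → new ≡ old → Shift i j p old new
shift-away p≢i p≢i+1 new≡old = same new≡old (λ (p≡i , _) → p≢i p≡i) (λ (p≡i+1 , _) → p≢i+1 p≡i+1)

shift-defined : ∀ {i j p old new} → Shift i j p old new → Is-just old ⇔ Is-just new
shift-defined (same refl _ _)      = mk⇔ (λ d → d) (λ d → d)
shift-defined (inc _ refl refl)    = mk⇔ (λ _ → just tt) (λ _ → just tt)
shift-defined (dec _ refl refl)    = mk⇔ (λ _ → just tt) (λ _ → just tt)

shift-nothing : ∀ {i j p old new} → Shift i j p old new → old ≡ nothing → new ≡ nothing
shift-nothing (same new≡old _ _) old≡ = trans new≡old old≡
shift-nothing (inc _ refl _)     ()
shift-nothing (dec _ refl _)     ()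

shift-nothing⁻ : ∀ {i j p old new} → Shift i j p old new → new ≡ nothing → old ≡ nothing
shift-nothing⁻ (same refl _ _) new≡ = new≡
shift-nothing⁻ (inc _ _ refl)  ()
shift-nothing⁻ (dec _ _ refl)  ()

raise-defined : ∀ r U → Is-just (raise r U) ⇔ Is-just (rightmostUnpaired r U)
raise-defined r U with rightmostUnpaired r U
... | just _  = mk⇔ (λ _ → just tt) (λ _ → just tt)
... | nothing = mk⇔ (λ ()) (λ ())

raise-inv : ∀ r U {V} → raise r U ≡ just V →
  ∃ λ w → rightmostUnpaired r U ≡ just w × V ≡ move (w , suc r) (w , r) U
raise-inv r U e with rightmostUnpaired r U
raise-inv r U refl | just w = w , refl , refl

rectify-just : ∀ c U {z} → lowestUnpaired c U ≡ just z → rectify c U ≡ move (suc c , z) (c , z) U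
rectify-just c U e rewrite e = refl

rectify-nothing : ∀ c U → lowestUnpaired c U ≡ nothing → rectify c U ≡ U
rectify-nothing c U e rewrite e = refl

module Interaction (T : Diagram) (r c : ℕ) where
  open LocalForm T r c

  a₀ a₁ b₀ b₁ : Bool
  a₀ = mem T (c , r)
  a₁ = mem T (suc c , r)
  b₀ = mem T (c , suc r)
  b₁ = mem T (suc c , suc r)

  κ ρ : Maybe ℕ
  κ = rightmostUnpaired r T
  ρ = lowestUnpaired c T

  rectAt : ℕ → Diagram
  rectAt z = move (suc c , z) (c , z) T
  raiseAt : ℕ → Diagram
  raiseAt w = move (w , suc r) (w , r) T

  M≤rowBound : M ≤ rowBound
  M≤rowBound = ≤-trans (m≤n+m M 2) (m≤n+m (2 + M) c)
  M≤colBound : M ≤ colBound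
  M≤colBound = ≤-trans (m≤n+m M 2) (m≤n+m (2 + M) r)

  κ-form : κ ≡ rowEnd (rowBlock a₀ b₀ a₁ b₁ s₀)
  κ-form = rowForm T (Bounded-mono T M≤rowBound (bounded-by-bound T)) (λ _ _ → refl , refl)

  ρ-form : ρ ≡ colEnd (colBlock a₀ a₁ b₀ b₁ st₀)
  ρ-form = colForm T (Bounded-mono T M≤colBound (bounded-by-bound T)) (λ _ _ → refl , refl)

  κ<M : ∀ {w} → κ ≡ just w → w < M
  κ<M e = rowFold-within lowT upT (upTo M) 0 nothing (all-upTo M) (λ ())
            (trans (sym (rowScan≡rowFold r T (range T) 0 nothing)) e)

  ρ<M : ∀ {z} → ρ ≡ just z → z < M
  ρ<M e = last-within (colFold-within leftT rightT (upTo M) [] (all-upTo M) [])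
            (trans (cong last (sym (colScan≡colFold c T (range T) []))) e)

  rectAt-bounded : ∀ {z} → z < M → Bounded rowBound (rectAt z)
  rectAt-bounded z<M = Bounded-move (suc c , _) (c , _) T (Bounded-mono T M≤rowBound (bounded-by-bound T))
    (m<m+n c z<s) (<-≤-trans z<M M≤rowBound)

  raiseAt-bounded : ∀ {w} → w < M → Bounded colBound (raiseAt w)
  raiseAt-bounded w<M = Bounded-move (_ , suc r) (_ , r) T (Bounded-mono T M≤colBound (bounded-by-bound T))
    (<-≤-trans w<M M≤colBound) (m<m+n r z<s)

  rectAt-agree : ∀ z → RowAgree (rectAt z)
  rectAt-agree z x≢c x≢c+1 = mem-move-other (suc c , z) (c , z) T (,≢ˡ x≢c) (,≢ˡ x≢c+1) ,
                         mem-move-other (suc c , z) (c , z) T (,≢ˡ x≢c) (,≢ˡ x≢c+1)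

  raiseAt-agree : ∀ w → ColAgree (raiseAt w)
  raiseAt-agree w y≢r y≢r+1 = mem-move-other (w , suc r) (w , r) T (,≢ʳ y≢r) (,≢ʳ y≢r+1) ,
                         mem-move-other (w , suc r) (w , r) T (,≢ʳ y≢r) (,≢ʳ y≢r+1)

  κ′ ρ′ : ℕ → Maybe ℕ
  κ′ z = rightmostUnpaired r (rectAt z)
  ρ′ w = lowestUnpaired c (raiseAt w)

  rowAnswer : (a₀ b₀ a₁ b₁ : Bool) → Maybe ℕ
  rowAnswer a₀ b₀ a₁ b₁ = rowEnd (rowBlock a₀ b₀ a₁ b₁ s₀)

  colAnswer : (a₀ a₁ b₀ b₁ : Bool) → Maybe ℕ
  colAnswer a₀ a₁ b₀ b₁ = colEnd (colBlock a₀ a₁ b₀ b₁ st₀)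

  κ′-form : ∀ {z} → z < M →
    κ′ z ≡ rowAnswer (mem (rectAt z) (c , r)) (mem (rectAt z) (c , suc r))
                     (mem (rectAt z) (suc c , r)) (mem (rectAt z) (suc c , suc r))
  κ′-form {z} z<M = rowForm (rectAt z) (rectAt-bounded z<M) (rectAt-agree z)

  ρ′-form : ∀ {w} → w < M →
    ρ′ w ≡ colAnswer (mem (raiseAt w) (c , r)) (mem (raiseAt w) (suc c , r))
                     (mem (raiseAt w) (c , suc r)) (mem (raiseAt w) (suc c , suc r))
  ρ′-form {w} w<M = colForm (raiseAt w) (raiseAt-bounded w<M) (raiseAt-agree w)

  at-c : κ ≡ just c → b₀ ≡ true × a₀ ≡ false × (b₁ ≡ true → a₁ ≡ true)
  at-c e = ends-at-c a₀ b₀ a₁ b₁ (proj₁ s₀) before₀ (trans (sym κ-form) e)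

  at-c+1 : κ ≡ just (suc c) → b₁ ≡ true × a₁ ≡ false × (a₀ ≡ true → b₀ ≡ true)
  at-c+1 e = ends-at-c+1 a₀ b₀ a₁ b₁ (proj₁ s₀) before₀ (trans (sym κ-form) e)

  at-r : ρ ≡ just r → a₀ ≡ false × a₁ ≡ true × (b₀ ≡ true → b₁ ≡ true)
  at-r e = ends-at-r a₀ a₁ b₀ b₁ (trans (sym ρ-form) e)

  at-r+1 : ρ ≡ just (suc r) → b₀ ≡ false × b₁ ≡ true × (a₁ ≡ true → a₀ ≡ true)
  at-r+1 e = ends-at-r+1 a₀ a₁ b₀ b₁ (trans (sym ρ-form) e)

  no-cross : ρ ≡ just r → κ ≢ just (suc c)
  no-cross ρ≡r κ≡c+1 with () ← trans (sym (proj₁ (proj₂ (at-r ρ≡r)))) (proj₁ (proj₂ (at-c+1 κ≡c+1)))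

  no-cross′ : ρ ≡ just (suc r) → κ ≢ just c
  no-cross′ ρ≡r+1 κ≡c with () ← trans (sym (proj₁ (at-c κ≡c))) (proj₁ (at-r+1 ρ≡r+1))

  rowShift : ∀ {z} → ρ ≡ just z → Shift r c z κ (κ′ z)
  rowShift {z} ρ≡z with z ≟ r | z ≟ suc r
  ... | yes refl | _ with at-r ρ≡z
  ...   | a₀≡f , a₁≡t , b₀→b₁ =
    shift-at (step-cong old new (lower-crosses b₀ b₁ (proj₁ s₀) before₀ b₀→b₁))
    where
    old : κ ≡ rowAnswer false b₀ true b₁
    old = trans κ-form (cong₄ rowAnswer a₀≡f (refl {x = b₀}) a₁≡t (refl {x = b₁}))
    new : κ′ r ≡ rowAnswer true b₀ false b₁
    new = trans (κ′-form (ρ<M ρ≡z)) (cong₄ rowAnswer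
      (mem-move-target (suc c , r) (c , r) T)
      (mem-move-other (suc c , r) (c , r) T (,≢ʳ (1+n≢n)) (,≢ʳ (1+n≢n)))
      (mem-move-source (suc c , r) (c , r) T (,≢ˡ 1+n≢n))
      (mem-move-other (suc c , r) (c , r) T (,≢ʳ 1+n≢n) (,≢ʳ 1+n≢n)))
  rowShift {z} ρ≡z | no _ | yes refl with at-r+1 ρ≡z
  ...   | b₀≡f , b₁≡t , a₁→a₀ =
    shift-at-suc (step-cong old new (upper-crosses a₀ a₁ (proj₁ s₀) before₀ a₁→a₀))
    where
    old : κ ≡ rowAnswer a₀ false a₁ true
    old = trans κ-form (cong₄ rowAnswer (refl {x = a₀}) b₀≡f (refl {x = a₁}) b₁≡t)
    new : κ′ (suc r) ≡ rowAnswer a₀ true a₁ false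
    new = trans (κ′-form (ρ<M ρ≡z)) (cong₄ rowAnswer
      (mem-move-other (suc c , suc r) (c , suc r) T (,≢ʳ (n≢1+n r)) (,≢ʳ (n≢1+n r)))
      (mem-move-target (suc c , suc r) (c , suc r) T)
      (mem-move-other (suc c , suc r) (c , suc r) T (,≢ʳ (n≢1+n r)) (,≢ʳ (n≢1+n r)))
      (mem-move-source (suc c , suc r) (c , suc r) T (,≢ˡ 1+n≢n)))
  rowShift {z} ρ≡z | no z≢r | no z≢r+1 = shift-away z≢r z≢r+1 (trans (κ′-form (ρ<M ρ≡z))
    (trans (cong₄ rowAnswer (untouched z≢r) (untouched z≢r+1) (untouched z≢r) (untouched z≢r+1)) (sym κ-form)))
    where
    untouched : ∀ {x y} → z ≢ y → mem (rectAt z) (x , y) ≡ mem T (x , y)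
    untouched z≢y = mem-move-other (suc c , z) (c , z) T (,≢ʳ (≢-sym z≢y)) (,≢ʳ (≢-sym z≢y))

  colShift : ∀ {w} → κ ≡ just w → Shift c r w ρ (ρ′ w)
  colShift {w} κ≡w with w ≟ c | w ≟ suc c
  ... | yes refl | _ with at-c κ≡w
  ...   | b₀≡t , a₀≡f , b₁→a₁ = shift-at (step-cong old new (left-crosses a₁ b₁ b₁→a₁))
    where
    old : ρ ≡ colAnswer false a₁ true b₁
    old = trans ρ-form (cong₄ colAnswer a₀≡f (refl {x = a₁}) b₀≡t (refl {x = b₁}))
    new : ρ′ c ≡ colAnswer true a₁ false b₁
    new = trans (ρ′-form (κ<M κ≡w)) (cong₄ colAnswer
      (mem-move-target (c , suc r) (c , r) T)
      (mem-move-other (c , suc r) (c , r) T (,≢ˡ 1+n≢n) (,≢ˡ 1+n≢n))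
      (mem-move-source (c , suc r) (c , r) T (,≢ʳ 1+n≢n))
      (mem-move-other (c , suc r) (c , r) T (,≢ˡ 1+n≢n) (,≢ˡ 1+n≢n)))
  colShift {w} κ≡w | no _ | yes refl with at-c+1 κ≡w
  ...   | b₁≡t , a₁≡f , a₀→b₀ = shift-at-suc (step-cong old new (right-crosses a₀ b₀ a₀→b₀))
    where
    old : ρ ≡ colAnswer a₀ false b₀ true
    old = trans ρ-form (cong₄ colAnswer (refl {x = a₀}) a₁≡f (refl {x = b₀}) b₁≡t)
    new : ρ′ (suc c) ≡ colAnswer a₀ true b₀ false
    new = trans (ρ′-form (κ<M κ≡w)) (cong₄ colAnswer
      (mem-move-other (suc c , suc r) (suc c , r) T (,≢ˡ (n≢1+n c)) (,≢ˡ (n≢1+n c)))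
      (mem-move-target (suc c , suc r) (suc c , r) T)
      (mem-move-other (suc c , suc r) (suc c , r) T (,≢ˡ (n≢1+n c)) (,≢ˡ (n≢1+n c)))
      (mem-move-source (suc c , suc r) (suc c , r) T (,≢ʳ 1+n≢n)))
  colShift {w} κ≡w | no w≢c | no w≢c+1 = shift-away w≢c w≢c+1 (trans (ρ′-form (κ<M κ≡w))
    (trans (cong₄ colAnswer (untouched w≢c) (untouched w≢c+1) (untouched w≢c) (untouched w≢c+1)) (sym ρ-form)))
    where
    untouched : ∀ {x y} → w ≢ x → mem (raiseAt w) (x , y) ≡ mem T (x , y)
    untouched w≢x = mem-move-other (w , suc r) (w , r) T (,≢ˡ (≢-sym w≢x)) (,≢ˡ (≢-sym w≢x))

  -- In the generic case the two moves are disjoint, so they commute.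
  apart : ∀ {z w} → ρ ≡ just z → κ ≡ just w →
    move (w , suc r) (w , r) (rectAt z) ≐ move (suc c , z) (c , z) (raiseAt w)
  apart {z} {w} ρ≡z κ≡w = move-comm (suc c , z) (c , z) (w , suc r) (w , r) T
    (λ e → no-cross (subst (λ y → ρ ≡ just y) (sym (,-injectiveʳ e)) ρ≡z)
                    (trans κ≡w (cong just (,-injectiveˡ e))))
    (λ e → no-cross′ (trans ρ≡z (cong just (,-injectiveʳ e)))
                     (subst (λ x → κ ≡ just x) (sym (,-injectiveˡ e)) κ≡w))

  -- The square: both composites move (c+1, r+1) to (c, r), refilling the
  -- occupied cell (c+1, r), resp. (c, r+1), on the way.
  square : ρ ≡ just r → κ ≡ just c →
    move (suc c , suc r) (suc c , r) (rectAt r) ≐ move (suc c , suc r) (c , suc r) (raiseAt c)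
  square ρ≡r κ≡c q =
    trans (move-refill (suc c , suc r) (suc c , r) (c , r) T (proj₁ (proj₂ (at-r ρ≡r)))
                       (,≢ʳ (n≢1+n r)) (,≢ˡ (n≢1+n c)) q)
          (sym (move-refill (suc c , suc r) (c , suc r) (c , r) T (proj₁ (at-c κ≡c))
                            (,≢ˡ (n≢1+n c)) (,≢ˡ (n≢1+n c)) q))

  -- The diagonal: both composites move (c+1, r+1) to (c, r) through the
  -- empty cell (c, r+1), resp. (c+1, r).
  diagonal : ρ ≡ just (suc r) → κ ≡ just (suc c) →
    move (c , suc r) (c , r) (rectAt (suc r)) ≐ move (suc c , r) (c , r) (raiseAt (suc c))
  diagonal ρ≡r+1 κ≡c+1 q =
    trans (move-through (suc c , suc r) (c , suc r) (c , r) T (proj₁ (at-r+1 ρ≡r+1)) q)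
          (sym (move-through (suc c , suc r) (suc c , r) (c , r) T (proj₁ (proj₂ (at-c+1 κ≡c+1))) q))

  interchange : ∀ {z w w′ z′} → ρ ≡ just z → κ ≡ just w → κ′ z ≡ just w′ → ρ′ w ≡ just z′ →
    move (w′ , suc r) (w′ , r) (rectAt z) ≐ move (suc c , z′) (c , z′) (raiseAt w)
  interchange ρ≡z κ≡w κ′≡w′ ρ′≡z′ with rowShift ρ≡z | colShift κ≡w
  ... | same κ′≡κ _ _ | same ρ′≡ρ _ _
    with refl ← answer-unique (trans κ′≡κ κ≡w) κ′≡w′
       | refl ← answer-unique (trans ρ′≡ρ ρ≡z) ρ′≡z′ = apart ρ≡z κ≡w
  ... | inc refl κ≡c κ′≡c+1 | inc refl ρ≡r ρ′≡r+1
    with refl ← answer-unique κ′≡c+1 κ′≡w′ | refl ← answer-unique ρ′≡r+1 ρ′≡z′ = square ρ≡r κ≡c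
  ... | dec refl κ≡c+1 κ′≡c | dec refl ρ≡r+1 ρ′≡r
    with refl ← answer-unique κ′≡c κ′≡w′ | refl ← answer-unique ρ′≡r ρ′≡z′ = diagonal ρ≡r+1 κ≡c+1
  ... | same _ ¬at _ | inc refl ρ≡r _ = ⊥-elim (¬at (answer-unique ρ≡z ρ≡r , κ≡w))
  ... | same _ _ ¬at | dec refl ρ≡r+1 _ = ⊥-elim (¬at (answer-unique ρ≡z ρ≡r+1 , κ≡w))
  ... | inc refl κ≡c _ | same _ ¬at _ = ⊥-elim (¬at (answer-unique κ≡w κ≡c , ρ≡z))
  ... | dec refl κ≡c+1 _ | same _ _ ¬at = ⊥-elim (¬at (answer-unique κ≡w κ≡c+1 , ρ≡z))
  ... | inc _ κ≡c _ | dec refl _ _ = ⊥-elim (n≢1+n c (answer-unique κ≡c κ≡w))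
  ... | dec _ κ≡c+1 _ | inc refl _ _ = ⊥-elim (n≢1+n c (answer-unique κ≡w κ≡c+1))

  raise-defined-iff : Is-just (raise r T) ⇔ Is-just (raise r (rectify c T))
  raise-defined-iff with ρ in ρ≡
  ... | nothing = ⇔-refl
  ... | just z  =
    ⇔-trans (raise-defined r T) (⇔-trans (shift-defined (rowShift ρ≡)) (⇔-sym (raise-defined r (rectAt z))))

  raise-rectify : ∀ T₁ T₂ → raise r T ≡ just T₁ → raise r (rectify c T) ≡ just T₂ → T₂ ≋ rectify c T₁
  raise-rectify T₁ T₂ e₁ e₂ with raise-inv r T e₁
  ... | w , κ≡w , refl = by-ρ ρ refl e₂
    where
    by-ρ : ∀ o → ρ ≡ o → raise r (rectify c T) ≡ just T₂ → T₂ ≋ rectify c (raiseAt w)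
    by-ρ nothing ρ≡ e₂
      rewrite rectify-nothing c T ρ≡ | rectify-nothing c (raiseAt w) (shift-nothing (colShift κ≡w) ρ≡)
      with raise-inv r T e₂
    ... | w₂ , κ≡w₂ , refl with refl ← answer-unique κ≡w κ≡w₂ = ≐⇒≋ (λ _ → refl)
    by-ρ (just z) ρ≡ e₂ rewrite rectify-just c T ρ≡ with raise-inv r (rectAt z) e₂
    ... | w′ , κ′≡w′ , refl = by-ρ′ (ρ′ w) refl
      where
      by-ρ′ : ∀ o → ρ′ w ≡ o → move (w′ , suc r) (w′ , r) (rectAt z) ≋ rectify c (raiseAt w)
      by-ρ′ (just z′) ρ′≡ rewrite rectify-just c (raiseAt w) ρ′≡ = ≐⇒≋ (interchange ρ≡ κ≡w κ′≡w′ ρ′≡)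
      by-ρ′ nothing   ρ′≡ with () ← trans (sym ρ≡) (shift-nothing⁻ (colShift κ≡w) ρ′≡)

-- Theorem 4.10.
theorem4p10 : (T : Diagram) (r c : ℕ) → All PositiveCell T → 1 ≤ r → 1 ≤ c →
    (Is-just (raise r T) ⇔ Is-just (raise r (rectify c T)))
    × (∀ (T₁ T₂ : Diagram) → raise r T ≡ just T₁ → raise r (rectify c T) ≡ just T₂ →
         T₂ ≋ rectify c T₁)
theorem4p10 T r c _ _ _ = raise-defined-iff , raise-rectify
  where open Interaction T r c
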